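{- The translations $(\cdot)^d$ and $(\cdot)^r$ satisfy: (i) $(s^r)^d\equiv s$ for every ordinary $\lambda$-term $s$ (built from variables, abstraction and ordinary application only); (ii) there exist a differential $\lambda$-term $S$ with $(S^r)^d\not\equiv S$ and a sum of resource terms $\mathbb{M}$ with $(\mathbb{M}^d)^r\not\equiv\mathbb{M}$; (iii) $\lambda\beta\eta^d\vdash(S^r)^d=S$ for every differential $\lambda$-term $S$; (iv) $\lambda\beta^r\vdash(\mathbb{M}^d)^r=\mathbb{M}$ for every finite sum $\mathbb{M}$ of resource $\lambda$-terms.
   Context: $\equiv$ denotes syntactic identity modulo the stated structural equivalences. Differential $\lambda$-calculus: differential $\lambda$-terms $S::=0\mid s\mid s+S$, simple terms $s,t::=x\mid\lambda x.s\mid sT\mid\mathsf{D}s\cdot t$, modulo $\alpha$, AC of $+$ with unit $0$, permutation of the arguments of $\mathsf{D}^ns\cdot(t_1..t_n)$ ($\mathsf{D}^0s\cdot()=s$, $\mathsf{D}^{n+1}s\cdot(t,t_1..t_n)=\mathsf{D}^n(\mathsf{D}s\cdot t)\cdot(t_1..t_n)$); abbreviations $\lambda x.\sum s_i=\sum\lambda x.s_i$, $(\sum s_i)T=\sum s_iT$, $\mathsf{D}(\sum s_i)\cdot(\sum t_j)=\sum\mathsf{D}s_i\cdot t_j$. Differential substitution: $\frac{\partial y}{\partial x}\cdot T=T$ if $y=x$ else $0$; $\frac{\partial(sU)}{\partial x}\cdot T=(\frac{\partial s}{\partial x}\cdot T)U+(\mathsf{D}s\cdot(\frac{\partial U}{\partial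 x}\cdot T))U$; $\frac{\partial(\lambda y.s)}{\partial x}\cdot T=\lambda y.\frac{\partial s}{\partial x}\cdot T$; $\frac{\partial(\mathsf{D}^ns\cdot(u_1..u_n))}{\partial x}\cdot T=\mathsf{D}^n(\frac{\partial s}{\partial x}\cdot T)\cdot(u)+\sum_i\mathsf{D}^ns\cdot(u_1,..,\frac{\partial u_i}{\partial x}\cdot T,..,u_n)$; $0\mapsto0$; linear on sums. $\lambda\beta\eta^d$: least equivalence on differential $\lambda$-terms compatible with abstraction, application, linear application and sums, containing $(\lambda x.s)T=s\{T/x\}$, $\mathsf{D}(\lambda x.s)\cdot t=\lambda x.\frac{\partial s}{\partial x}\cdot t$ and $\lambda x.sx=s$ for $x\notin\mathrm{FV}(s)$. Resource calculus: terms $M::=x\mid\lambda x.M\mid MP$; bags $P=[M_1^{(!)},..,M_n^{(!)}]$ (finite multisets of $M$ or $M^!$); finite formal sums with unit $0$; extension to sums: $\lambda x.\sum M_i=\sum\lambda x.M_i$, $(\sum M_i)(\sum P_j)=\sum M_iP_j$, $[\sum M_i]\uplus P=\sum[M_i]\uplus P$, $[(\sum_{i=1}^kM_i)^!]\uplus P=[M_1^!,..,M_k^!]\uplus P$. Linear substitution: $y\langle N/x\rangle=N$ if $y=x$ else $0$; $(\lambda y.M)\langle N/x\rangle=\lambda y.M\langle N/x\rangle$; $(MP)\langle N/x\rangle=M\langle N/x\rangle P+M(P\langle N/x\rangle)$; $[M]\langle N/x\rangle=[M\langle N/x\rangle]$; $[]\langle N/x\rangle=0$; $[M^!]\langle N/x\rangle=[M\langle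 N/x\rangle,M^!]$; $(P\uplus R)\langle N/x\rangle=P\langle N/x\rangle\uplus R+P\uplus R\langle N/x\rangle$; bilinear. $\lambda\beta^r$: least equivalence on sums (same sort) compatible with abstraction, application, bag formation and sums, containing $(\lambda x.M)[L_1,..,L_k,N_1^!,..,N_n^!]=M\langle L_1/x\rangle\cdots\langle L_k/x\rangle\{\sum_iN_i/x\}$. Translations: $x^d=x$, $(\lambda x.M)^d=\lambda x.M^d$, $(M[L_1..L_k,N_1^!..N_n^!])^d=(\mathsf{D}^kM^d\cdot(L_1^d..L_k^d))(\sum_iN_i^d)$, $(\sum M_i)^d=\sum M_i^d$. $x^r=x$, $(\lambda x.s)^r=\lambda x.s^r$, $(sT)^r=s^r[(T^r)^!]$, $(\mathsf{D}^ks\cdot(t_1..t_k))^r=\lambda y.s^r[t_1^r,..,t_k^r,y^!]$ ($k\ge1$, $y$ fresh), $(s+S)^r=s^r+S^r$. -}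

module Defs where

open import Data.Bool using (if_then_else_)
open import Data.Nat using (ℕ; zero; suc; _+_; _≡ᵇ_; compare; less; equal; greater)
open import Data.List using (List; []; _∷_; [_]; _++_; map; concatMap; foldl)
open import Data.List.Relation.Binary.Permutation.Homogeneous using (Permutation)

-- Conventions: variables are de Bruijn indices (this quotients by α).
-- Finite formal sums are lists; equality of sums up to associativity,
-- commutativity and unit 0 (= []) is 'Permutation' (stdlib, homogeneous)
-- up to the element equivalence.  The sum-extended constructors (the
-- "abbreviations" of the paper) are explicit (multi)linear operations.

liftVar : ℕ → ℕ → ℕ
liftVar zero    n       = suc n
liftVar (suc c) zero    = zero
liftVar (suc c) (suc n) = suc (liftVar c n)

-- replace variable i by U (a sum) and decrement the variables above i
substVar : {A : Set} → (ℕ → A) → ℕ → ℕ → List A → List A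
substVar v i n U with compare n i
... | less .n k      = [ v n ]
... | equal .n       = U
... | greater .i k   = [ v (i + k) ]

-- Differential λ-calculus

data Tm : Set where
  var : ℕ → Tm
  lam : Tm → Tm
  app : Tm → List Tm → Tm
  dif : Tm → Tm → Tm

Sum : Set
Sum = List Tm

lamS : Sum → Sum
lamS = map lam

appS : Sum → Sum → Sum
appS S T = map (λ s → app s T) S

difS : Sum → Sum → Sum
difS S T = concatMap (λ s → map (dif s) T) S

Dⁿ : Tm → List Tm → Tm
Dⁿ s []       = s
Dⁿ s (t ∷ ts) = Dⁿ (dif s t) ts

mutual
  sh : ℕ → Tm → Tm
  sh c (var n)   = var (liftVar c n)
  sh c (lam s)   = lam (sh (suc c) s)
  sh c (app s T) = app (sh c s) (shs c T)
  sh c (dif s t) = dif (sh c s) (sh c t)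

  shs : ℕ → Sum → Sum
  shs c []      = []
  shs c (t ∷ T) = sh c t ∷ shs c T

mutual
  subst : ℕ → Sum → Tm → Sum
  subst i U (var n)   = substVar var i n U
  subst i U (lam s)   = lamS (subst (suc i) (shs 0 U) s)
  subst i U (app s T) = appS (subst i U s) (substs i U T)
  subst i U (dif s t) = difS (subst i U s) (subst i U t)

  substs : ℕ → Sum → Sum → Sum
  substs i U []      = []
  substs i U (t ∷ T) = subst i U t ++ substs i U T

-- differential substitution  ∂s/∂xᵢ · T ; the clause for D s·u is the
-- binary instance of the paper's n-ary clause (they agree on D^n s·(u)).
mutual
  ∂ : ℕ → Sum → Tm → Sum
  ∂ i T (var n)   = if n ≡ᵇ i then T else []
  ∂ i T (lam s)   = lamS (∂ (suc i) (shs 0 T) s)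
  ∂ i T (app s U) = appS (∂ i T s) U ++ appS (difS [ s ] (∂s i T U)) U
  ∂ i T (dif s u) = difS (∂ i T s) [ u ] ++ difS [ s ] (∂ i T u)

  ∂s : ℕ → Sum → Sum → Sum
  ∂s i T []      = []
  ∂s i T (u ∷ U) = ∂ i T u ++ ∂s i T U

mutual
  data _≈_ : Tm → Tm → Set where
    ≈refl  : ∀ {s} → s ≈ s
    ≈sym   : ∀ {s t} → s ≈ t → t ≈ s
    ≈trans : ∀ {s t u} → s ≈ t → t ≈ u → s ≈ u
    ≈lam   : ∀ {s s'} → s ≈ s' → lam s ≈ lam s'
    ≈app   : ∀ {s s' T T'} → s ≈ s' → T ≈ₛ T' → app s T ≈ app s' T'
    ≈dif   : ∀ {s s' t t'} → s ≈ s' → t ≈ t' → dif s t ≈ dif s' t'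
    ≈perm  : ∀ {s t u} → dif (dif s t) u ≈ dif (dif s u) t

  _≈ₛ_ : Sum → Sum → Set
  S ≈ₛ T = Permutation _≈_ S T

data _=βη_ : Sum → Sum → Set where
  struct : ∀ {S T} → S ≈ₛ T → S =βη T
  esym   : ∀ {S T} → S =βη T → T =βη S
  etrans : ∀ {S T U} → S =βη T → T =βη U → S =βη U
  clam   : ∀ {S S'} → S =βη S' → lamS S =βη lamS S'
  capp   : ∀ {S S' T T'} → S =βη S' → T =βη T' → appS S T =βη appS S' T'
  cdif   : ∀ {S S' T T'} → S =βη S' → T =βη T' → difS S T =βη difS S' T'
  csum   : ∀ {S S' T T'} → S =βη S' → T =βη T' → (S ++ T) =βη (S' ++ T')
  β      : ∀ s T → [ app (lam s) T ] =βη subst 0 T s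
  βᵈ     : ∀ s t → [ dif (lam s) t ] =βη lamS (∂ 0 [ sh 0 t ] s)
  η      : ∀ s → [ lam (app (sh 0 s) [ var 0 ]) ] =βη [ s ]

data Ordinary : Tm → Set where
  ovar : ∀ n → Ordinary (var n)
  olam : ∀ {s} → Ordinary s → Ordinary (lam s)
  oapp : ∀ {s t} → Ordinary s → Ordinary t → Ordinary (app s [ t ])

-- Resource calculus

mutual
  data RTm : Set where
    var : ℕ → RTm
    lam : RTm → RTm
    app : RTm → List BEl → RTm

  data BEl : Set where
    lin  : RTm → BEl
    bang : RTm → BEl

Bag : Set
Bag = List BEl

RSum : Set
RSum = List RTm

BSum : Set
BSum = List Bag

lamR : RSum → RSum
lamR = map lam

appR : RSum → BSum → RSum
appR Ms Ps = concatMap (λ M → map (app M) Ps) Ms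

linB : RSum → BSum → BSum
linB Ms Ps = concatMap (λ M → map (lin M ∷_) Ps) Ms

-- [(Σ Mᵢ)^!] ⊎ P = [M₁^!,..,M_k^!] ⊎ P
bangB : RSum → BSum → BSum
bangB Ms Ps = map (λ P → map bang Ms ++ P) Ps

mutual
  shR : ℕ → RTm → RTm
  shR c (var n)   = var (liftVar c n)
  shR c (lam M)   = lam (shR (suc c) M)
  shR c (app M P) = app (shR c M) (shB c P)

  shB : ℕ → Bag → Bag
  shB c []           = []
  shB c (lin M ∷ P)  = lin (shR c M) ∷ shB c P
  shB c (bang M ∷ P) = bang (shR c M) ∷ shB c P

shRs : ℕ → RSum → RSum
shRs c = map (shR c)

mutual
  substR : ℕ → RSum → RTm → RSum
  substR i L (var n)   = substVar var i n L
  substR i L (lam M)   = lamR (substR (suc i) (shRs 0 L) M)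
  substR i L (app M P) = appR (substR i L M) (substBag i L P)

  substBag : ℕ → RSum → Bag → BSum
  substBag i L []           = [ [] ]
  substBag i L (lin M ∷ P)  = linB (substR i L M) (substBag i L P)
  substBag i L (bang M ∷ P) = bangB (substR i L M) (substBag i L P)

mutual
  linR : ℕ → RTm → RTm → RSum
  linR i N (var n)   = if n ≡ᵇ i then [ N ] else []
  linR i N (lam M)   = lamR (linR (suc i) (shR 0 N) M)
  linR i N (app M P) = appR (linR i N M) [ P ] ++ appR [ M ] (linBag i N P)

  linBag : ℕ → RTm → Bag → BSum
  linBag i N []           = []
  linBag i N (lin M ∷ P)  =
    linB (linR i N M) [ P ] ++ map (lin M ∷_) (linBag i N P)
  linBag i N (bang M ∷ P) =
    linB (linR i N M) [ bang M ∷ P ] ++ map (bang M ∷_) (linBag i N P)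

linRs : ℕ → RTm → RSum → RSum
linRs i N Ms = concatMap (linR i N) Ms

substRs : ℕ → RSum → RSum → RSum
substRs i L Ms = concatMap (substR i L) Ms

linPart : Bag → List RTm
linPart []           = []
linPart (lin M ∷ P)  = M ∷ linPart P
linPart (bang M ∷ P) = linPart P

bangPart : Bag → List RTm
bangPart []           = []
bangPart (lin M ∷ P)  = bangPart P
bangPart (bang M ∷ P) = M ∷ bangPart P

-- right-hand side of β:  M⟨L₁/x⟩⋯⟨L_k/x⟩{Σ Nᵢ/x}
βʳ-rhs : RTm → Bag → RSum
βʳ-rhs M P =
  substRs 0 (bangPart P)
    (foldl (λ Ms L → linRs 0 (shR 0 L) Ms) [ M ] (linPart P))

-- structural equivalence: α (de Bruijn), bags are multisets, sums AC
mutual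
  data _≈ʳ_ : RTm → RTm → Set where
    ≈refl  : ∀ {M} → M ≈ʳ M
    ≈sym   : ∀ {M N} → M ≈ʳ N → N ≈ʳ M
    ≈trans : ∀ {M N L} → M ≈ʳ N → N ≈ʳ L → M ≈ʳ L
    ≈lam   : ∀ {M M'} → M ≈ʳ M' → lam M ≈ʳ lam M'
    ≈app   : ∀ {M M' P P'} → M ≈ʳ M' → Permutation _≈ᵉ_ P P' → app M P ≈ʳ app M' P'

  data _≈ᵉ_ : BEl → BEl → Set where
    ≈lin  : ∀ {M M'} → M ≈ʳ M' → lin M ≈ᵉ lin M'
    ≈bang : ∀ {M M'} → M ≈ʳ M' → bang M ≈ᵉ bang M'

_≈ᵇ_ : Bag → Bag → Set
P ≈ᵇ Q = Permutation _≈ᵉ_ P Q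

_≈ʳₛ_ : RSum → RSum → Set
Ms ≈ʳₛ Ns = Permutation _≈ʳ_ Ms Ns

_≈ᵇₛ_ : BSum → BSum → Set
Ps ≈ᵇₛ Qs = Permutation _≈ᵇ_ Ps Qs

mutual
  data _=βr_ : RSum → RSum → Set where
    struct : ∀ {Ms Ns} → Ms ≈ʳₛ Ns → Ms =βr Ns
    esym   : ∀ {Ms Ns} → Ms =βr Ns → Ns =βr Ms
    etrans : ∀ {Ms Ns Ls} → Ms =βr Ns → Ns =βr Ls → Ms =βr Ls
    clam   : ∀ {Ms Ms'} → Ms =βr Ms' → lamR Ms =βr lamR Ms'
    capp   : ∀ {Ms Ms' Ps Ps'} → Ms =βr Ms' → Ps =βb Ps' →
             appR Ms Ps =βr appR Ms' Ps'
    csum   : ∀ {Ms Ms' Ns Ns'} → Ms =βr Ms' → Ns =βr Ns' →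
             (Ms ++ Ns) =βr (Ms' ++ Ns')
    β      : ∀ M P → [ app (lam M) P ] =βr βʳ-rhs M P

  data _=βb_ : BSum → BSum → Set where
    struct : ∀ {Ps Qs} → Ps ≈ᵇₛ Qs → Ps =βb Qs
    esym   : ∀ {Ps Qs} → Ps =βb Qs → Qs =βb Ps
    etrans : ∀ {Ps Qs Rs} → Ps =βb Qs → Qs =βb Rs → Ps =βb Rs
    clin   : ∀ {Ms Ms' Ps Ps'} → Ms =βr Ms' → Ps =βb Ps' →
             linB Ms Ps =βb linB Ms' Ps'
    cbang  : ∀ {Ms Ms' Ps Ps'} → Ms =βr Ms' → Ps =βb Ps' →
             bangB Ms Ps =βb bangB Ms' Ps'
    csum   : ∀ {Ps Ps' Qs Qs'} → Ps =βb Ps' → Qs =βb Qs' →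
             (Ps ++ Qs) =βb (Ps' ++ Qs')

-- Translations

mutual
  toD : RTm → Tm
  toD (var n)   = var n
  toD (lam M)   = lam (toD M)
  toD (app M P) = app (Dⁿ (toD M) (toDLin P)) (toDBang P)

  toDLin : Bag → List Tm
  toDLin []           = []
  toDLin (lin M ∷ P)  = toD M ∷ toDLin P
  toDLin (bang M ∷ P) = toDLin P

  toDBang : Bag → Sum
  toDBang []           = []
  toDBang (lin M ∷ P)  = toDBang P
  toDBang (bang M ∷ P) = toD M ∷ toDBang P

toDs : RSum → Sum
toDs = map toD

-- (·)^r : differential → resource.  D^k s·(t₁..t_k) with k ≥ 1 maximal
-- (s not itself a linear application) ↦ λy. s^r [t₁^r,..,t_k^r, y^!]
mutual
  toR : Tm → RTm
  toR (var n)   = var n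
  toR (lam s)   = lam (toR s)
  toR (app s T) = app (toR s) (map bang (toRs T))
  toR (dif s t) = toRD s (toR t ∷ [])

  toRD : Tm → List RTm → RTm
  toRD (dif s t) acc = toRD s (toR t ∷ acc)
  toRD (var n)   acc = wrapD (var n) acc
  toRD (lam s)   acc = wrapD (lam (toR s)) acc
  toRD (app s T) acc = wrapD (app (toR s) (map bang (toRs T))) acc

  toRs : Sum → RSum
  toRs []      = []
  toRs (t ∷ T) = toR t ∷ toRs T

  wrapD : RTm → List RTm → RTm
  wrapD h ts = lam (app (shR 0 h) (map (λ t → lin (shR 0 t)) ts ++ [ bang (var 0) ]))

-- Both round trips differ from the identity only by a β- or η-step at each
-- linear application.  A nest D^k s·(t₁..t_k) is sent by (·)^r to the
-- η-expansion λy. s^r [t₁^r,..,t_k^r, y^!], so (·)^d turns it back into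
-- λy.(D^k s·(t₁..t_k)) y, an η-redex of the original term.  Conversely
-- (M[L₁..L_k, N^!])^d is D^k M^d·(L) (Σ N), whose (·)^r is
-- (λy. M^dr [L^dr, y^!]) [(N^dr)^!], a β-redex whose contractum is
-- M^dr [L^dr, (N^dr)^!].  These steps are not structural: the round trips
-- turn D x·x into an abstraction and x[x] into a β-redex, and structural
-- equivalence preserves being an abstraction and being a redex.
module Submission where

open import Defs
open import Data.List using ([_])
open import Data.Product using (_×_; Σ)
open import Relation.Nullary using (¬_)

open import Data.Bool using (Bool; true; false; T)
open import Data.Nat using (ℕ; zero; suc; compare; less; equal; greater)
open import Data.List using (List; []; _∷_; _++_; map)
open import Data.List.Properties using (++-identityʳ; map-∘)
open import Data.List.Relation.Unary.All using (All; []; _∷_)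
import Data.List.Relation.Binary.Pointwise.Properties as Pointwise
open import Data.List.Relation.Binary.Pointwise.Base using ([]; _∷_)
open import Data.List.Relation.Binary.Permutation.Homogeneous using (refl; prep)
import Data.List.Relation.Binary.Permutation.Setoid as ↭
import Data.List.Relation.Binary.Permutation.Setoid.Properties as ↭
open import Data.Product using (_,_)
open import Data.Unit using (tt)
open import Relation.Binary.Bundles using (Setoid)
open import Relation.Binary.PropositionalEquality
  using (_≡_; cong; cong₂; sym) renaming (refl to ≡-refl; trans to ≡-trans)
import Relation.Binary.PropositionalEquality as ≡

≈-setoid : Setoid _ _
≈-setoid = record
  { _≈_ = _≈_ ; isEquivalence = record { refl = ≈refl ; sym = ≈sym ; trans = ≈trans } }

≈ʳ-setoid : Setoid _ _
≈ʳ-setoid = record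
  { _≈_ = _≈ʳ_ ; isEquivalence = record { refl = ≈refl ; sym = ≈sym ; trans = ≈trans } }

≈ᵉ-setoid : Setoid _ _
≈ᵉ-setoid = record
  { _≈_ = _≈ᵉ_ ; isEquivalence = record { refl = ≈ᵉ-refl ; sym = ≈ᵉ-sym ; trans = ≈ᵉ-trans } }
  where
  ≈ᵉ-refl : ∀ {e} → e ≈ᵉ e
  ≈ᵉ-refl {lin M}  = ≈lin ≈refl
  ≈ᵉ-refl {bang M} = ≈bang ≈refl

  ≈ᵉ-sym : ∀ {e e'} → e ≈ᵉ e' → e' ≈ᵉ e
  ≈ᵉ-sym (≈lin p)  = ≈lin (≈sym p)
  ≈ᵉ-sym (≈bang p) = ≈bang (≈sym p)

  ≈ᵉ-trans : ∀ {e e' e''} → e ≈ᵉ e' → e' ≈ᵉ e'' → e ≈ᵉ e''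
  ≈ᵉ-trans (≈lin p)  (≈lin q)  = ≈lin (≈trans p q)
  ≈ᵉ-trans (≈bang p) (≈bang q) = ≈bang (≈trans p q)

=βη-reflexive : ∀ {S T} → S ≡ T → S =βη T
=βη-reflexive ≡-refl = struct (refl (Pointwise.refl ≈refl))

=βr-reflexive : ∀ {Ms Ns} → Ms ≡ Ns → Ms =βr Ns
=βr-reflexive ≡-refl = struct (refl (Pointwise.refl ≈refl))

=βb-refl : ∀ {Ps} → Ps =βb Ps
=βb-refl = struct (refl (Pointwise.refl (↭.↭-refl ≈ᵉ-setoid)))

toD-toR-ordinary : ∀ s → Ordinary s → toD (toR s) ≈ s
toD-toR-ordinary _ (ovar n)   = ≈refl
toD-toR-ordinary _ (olam o)   = ≈lam (toD-toR-ordinary _ o)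
toD-toR-ordinary _ (oapp o u) =
  ≈app (toD-toR-ordinary _ o) (refl (toD-toR-ordinary _ u ∷ []))

isLam : Tm → Bool
isLam (lam _) = true
isLam _       = false

isLam-resp-≈ : ∀ {s t} → s ≈ t → isLam s ≡ isLam t
isLam-resp-≈ ≈refl        = ≡-refl
isLam-resp-≈ (≈sym p)     = sym (isLam-resp-≈ p)
isLam-resp-≈ (≈trans p q) = ≡-trans (isLam-resp-≈ p) (isLam-resp-≈ q)
isLam-resp-≈ (≈lam _)     = ≡-refl
isLam-resp-≈ (≈app _ _)   = ≡-refl
isLam-resp-≈ (≈dif _ _)   = ≡-refl
isLam-resp-≈ ≈perm        = ≡-refl

isLamʳ : RTm → Bool
isLamʳ (lam _) = true
isLamʳ _       = false

isLamʳ-resp-≈ʳ : ∀ {M N} → M ≈ʳ N → isLamʳ M ≡ isLamʳ N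
isLamʳ-resp-≈ʳ ≈refl        = ≡-refl
isLamʳ-resp-≈ʳ (≈sym p)     = sym (isLamʳ-resp-≈ʳ p)
isLamʳ-resp-≈ʳ (≈trans p q) = ≡-trans (isLamʳ-resp-≈ʳ p) (isLamʳ-resp-≈ʳ q)
isLamʳ-resp-≈ʳ (≈lam _)     = ≡-refl
isLamʳ-resp-≈ʳ (≈app _ _)   = ≡-refl

isRedexʳ : RTm → Bool
isRedexʳ (app M _) = isLamʳ M
isRedexʳ _         = false

isRedexʳ-resp-≈ʳ : ∀ {M N} → M ≈ʳ N → isRedexʳ M ≡ isRedexʳ N
isRedexʳ-resp-≈ʳ ≈refl        = ≡-refl
isRedexʳ-resp-≈ʳ (≈sym p)     = sym (isRedexʳ-resp-≈ʳ p)
isRedexʳ-resp-≈ʳ (≈trans p q) = ≡-trans (isRedexʳ-resp-≈ʳ p) (isRedexʳ-resp-≈ʳ q)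
isRedexʳ-resp-≈ʳ (≈lam _)     = ≡-refl
isRedexʳ-resp-≈ʳ (≈app p _)   = isLamʳ-resp-≈ʳ p

toDs-toRs-not-≈ₛ : Σ Sum λ S → ¬ (toDs (toRs S) ≈ₛ S)
toDs-toRs-not-≈ₛ = [ dif (var 0) (var 0) ] , λ p →
  notLam (↭.All-resp-↭ ≈-setoid (λ q → ≡.subst T (isLam-resp-≈ q)) p (tt ∷ []))
  where
  notLam : ¬ All (λ s → T (isLam s)) [ dif (var 0) (var 0) ]
  notLam (() ∷ [])

toRs-toDs-not-≈ʳₛ : Σ RSum λ Ms → ¬ (toRs (toDs Ms) ≈ʳₛ Ms)
toRs-toDs-not-≈ʳₛ = [ app (var 0) [ lin (var 0) ] ] , λ p →
  notRedex (↭.All-resp-↭ ≈ʳ-setoid (λ q → ≡.subst T (isRedexʳ-resp-≈ʳ q)) p (tt ∷ []))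
  where
  notRedex : ¬ All (λ M → T (isRedexʳ M)) [ app (var 0) [ lin (var 0) ] ]
  notRedex (() ∷ [])

sh-Dⁿ : ∀ c s ts → sh c (Dⁿ s ts) ≡ Dⁿ (sh c s) (map (sh c) ts)
sh-Dⁿ c s []       = ≡-refl
sh-Dⁿ c s (t ∷ ts) = sh-Dⁿ c (dif s t) ts

shs≡map-sh : ∀ c T → shs c T ≡ map (sh c) T
shs≡map-sh c []      = ≡-refl
shs≡map-sh c (t ∷ T) = cong (sh c t ∷_) (shs≡map-sh c T)

mutual
  toD-shR : ∀ c M → toD (shR c M) ≡ sh c (toD M)
  toD-shR c (var n)   = ≡-refl
  toD-shR c (lam M)   = cong lam (toD-shR (suc c) M)
  toD-shR c (app M P) = cong₂ app
    (≡-trans (cong₂ Dⁿ (toD-shR c M) (toDLin-shB c P)) (sym (sh-Dⁿ c (toD M) (toDLin P))))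
    (≡-trans (toDBang-shB c P) (sym (shs≡map-sh c (toDBang P))))

  toDLin-shB : ∀ c P → toDLin (shB c P) ≡ map (sh c) (toDLin P)
  toDLin-shB c []           = ≡-refl
  toDLin-shB c (lin M ∷ P)  = cong₂ _∷_ (toD-shR c M) (toDLin-shB c P)
  toDLin-shB c (bang M ∷ P) = toDLin-shB c P

  toDBang-shB : ∀ c P → toDBang (shB c P) ≡ map (sh c) (toDBang P)
  toDBang-shB c []           = ≡-refl
  toDBang-shB c (lin M ∷ P)  = toDBang-shB c P
  toDBang-shB c (bang M ∷ P) = cong₂ _∷_ (toD-shR c M) (toDBang-shB c P)

toDLin-map-bang : ∀ Ms → toDLin (map bang Ms) ≡ []
toDLin-map-bang []       = ≡-refl
toDLin-map-bang (M ∷ Ms) = toDLin-map-bang Ms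

toDBang-map-bang : ∀ Ms → toDBang (map bang Ms) ≡ toDs Ms
toDBang-map-bang []       = ≡-refl
toDBang-map-bang (M ∷ Ms) = cong (toD M ∷_) (toDBang-map-bang Ms)

toD-wrapD : ∀ h ts → toD (wrapD h ts) ≡ lam (app (sh 0 (Dⁿ (toD h) (toDs ts))) [ var 0 ])
toD-wrapD h ts = cong lam (cong₂ app
  (≡-trans (cong₂ Dⁿ (toD-shR 0 h) (≡-trans (toDLin-wrap ts) (map-∘ ts)))
           (sym (sh-Dⁿ 0 (toD h) (toDs ts))))
  (toDBang-wrap ts))
  where
  toDLin-wrap : ∀ ts → toDLin (map (λ t → lin (shR 0 t)) ts ++ [ bang (var 0) ])
                       ≡ map (λ t → sh 0 (toD t)) ts
  toDLin-wrap []       = ≡-refl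
  toDLin-wrap (t ∷ ts) = cong₂ _∷_ (toD-shR 0 t) (toDLin-wrap ts)

  toDBang-wrap : ∀ ts → toDBang (map (λ t → lin (shR 0 t)) ts ++ [ bang (var 0) ]) ≡ [ var 0 ]
  toDBang-wrap []       = ≡-refl
  toDBang-wrap (t ∷ ts) = toDBang-wrap ts

Dⁿ-cong : ∀ {s s'} us → [ s ] =βη [ s' ] → All (λ u → [ toD (toR u) ] =βη [ u ]) us →
          [ Dⁿ s (toDs (toRs us)) ] =βη [ Dⁿ s' us ]
Dⁿ-cong []       e []       = e
Dⁿ-cong (u ∷ us) e (d ∷ ds) = Dⁿ-cong us (cdif e d) ds

mutual
  toD-toR : ∀ s → [ toD (toR s) ] =βη [ s ]
  toD-toR (var n)   = =βη-reflexive ≡-refl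
  toD-toR (lam s)   = clam (toD-toR s)
  toD-toR (app s T) = etrans
    (=βη-reflexive (cong₂ (λ s' T' → [ app s' T' ])
      (cong (Dⁿ (toD (toR s))) (toDLin-map-bang (toRs T))) (toDBang-map-bang (toRs T))))
    (capp (toD-toR s) (toDs-toRs T))
  toD-toR (dif s t) = toD-toRD s [ t ] (toD-toR t ∷ [])

  toD-toRD : ∀ s us → All (λ u → [ toD (toR u) ] =βη [ u ]) us →
             [ toD (toRD s (toRs us)) ] =βη [ Dⁿ s us ]
  toD-toRD (dif s t) us ds = toD-toRD s (t ∷ us) (toD-toR t ∷ ds)
  toD-toRD (var n)   us ds = toD-toRD-wrap (var n) us ds
  toD-toRD (lam s)   us ds = toD-toRD-wrap (lam s) us ds
  toD-toRD (app s T) us ds = toD-toRD-wrap (app s T) us ds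

  toD-toRD-wrap : ∀ h us → All (λ u → [ toD (toR u) ] =βη [ u ]) us →
                  [ toD (wrapD (toR h) (toRs us)) ] =βη [ Dⁿ h us ]
  toD-toRD-wrap h us ds = etrans (=βη-reflexive (cong [_] (toD-wrapD (toR h) (toRs us))))
    (etrans (η _) (Dⁿ-cong us (toD-toR h) ds))

  toDs-toRs : ∀ S → toDs (toRs S) =βη S
  toDs-toRs []      = =βη-reflexive ≡-refl
  toDs-toRs (t ∷ T) = csum (toD-toR t) (toDs-toRs T)

substVar-suc : ∀ {A : Set} (v : ℕ → A) i n L →
               substVar v (suc i) (suc n) L ≡ substVar (λ m → v (suc m)) i n L
substVar-suc v i n L with compare n i
... | less .n k    = ≡-refl
... | equal .n     = ≡-refl
... | greater .i k = ≡-refl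

substVar-liftVar : ∀ {A : Set} (v : ℕ → A) i n L → substVar v i (liftVar i n) L ≡ [ v n ]
substVar-liftVar v zero    n       L = ≡-refl
substVar-liftVar v (suc i) zero    L = ≡-refl
substVar-liftVar v (suc i) (suc n) L =
  ≡-trans (substVar-suc v i (liftVar i n) L) (substVar-liftVar (λ m → v (suc m)) i n L)

mutual
  substR-shR : ∀ i L M → substR i L (shR i M) ≡ [ M ]
  substR-shR i L (var n)   = substVar-liftVar var i n L
  substR-shR i L (lam M)   = cong lamR (substR-shR (suc i) (shRs 0 L) M)
  substR-shR i L (app M P) = cong₂ appR (substR-shR i L M) (substBag-shB i L P)

  substBag-shB : ∀ i L P → substBag i L (shB i P) ≡ [ P ]
  substBag-shB i L []           = ≡-refl
  substBag-shB i L (lin M ∷ P)  = cong₂ linB (substR-shR i L M) (substBag-shB i L P)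
  substBag-shB i L (bang M ∷ P) = cong₂ bangB (substR-shR i L M) (substBag-shB i L P)

substBag-wrap : ∀ Ns Ls → substBag 0 Ns (map (λ t → lin (shR 0 t)) Ls ++ [ bang (var 0) ])
                          ≡ [ map lin Ls ++ map bang Ns ]
substBag-wrap Ns []       = cong [_] (++-identityʳ (map bang Ns))
substBag-wrap Ns (L ∷ Ls) = cong₂ linB (substR-shR 0 Ns L) (substBag-wrap Ns Ls)

linPart-map-bang : ∀ Ms → linPart (map bang Ms) ≡ []
linPart-map-bang []       = ≡-refl
linPart-map-bang (M ∷ Ms) = linPart-map-bang Ms

bangPart-map-bang : ∀ Ms → bangPart (map bang Ms) ≡ Ms
bangPart-map-bang []       = ≡-refl
bangPart-map-bang (M ∷ Ms) = cong (M ∷_) (bangPart-map-bang Ms)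

wrapD-β : ∀ M Ls Ns → [ app (wrapD M Ls) (map bang Ns) ] =βr [ app M (map lin Ls ++ map bang Ns) ]
wrapD-β M Ls Ns = etrans (β _ _) (=βr-reflexive contractum)
  where
  contractum : βʳ-rhs (app (shR 0 M) (map (λ t → lin (shR 0 t)) Ls ++ [ bang (var 0) ]))
                      (map bang Ns)
               ≡ [ app M (map lin Ls ++ map bang Ns) ]
  contractum rewrite linPart-map-bang Ns | bangPart-map-bang Ns
                   | substR-shR 0 Ns M | substBag-wrap Ns Ls = ≡-refl

toR-Dⁿ-dif : ∀ s t ts → toR (Dⁿ (dif s t) ts) ≡ toRD s (toR t ∷ toRs ts)
toR-Dⁿ-dif s t []        = ≡-refl
toR-Dⁿ-dif s t (t' ∷ ts) = toR-Dⁿ-dif (dif s t) t' ts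

-- (·)^d never produces a linear application at the head, so (·)^r wraps it directly.
toRD-toD : ∀ M Ls → toRD (toD M) Ls ≡ wrapD (toR (toD M)) Ls
toRD-toD (var n)   Ls = ≡-refl
toRD-toD (lam M)   Ls = ≡-refl
toRD-toD (app M P) Ls = ≡-refl

toR-Dⁿ-toD-β : ∀ M ts Ns → [ app (toR (Dⁿ (toD M) ts)) (map bang Ns) ]
                           =βr [ app (toR (toD M)) (map lin (toRs ts) ++ map bang Ns) ]
toR-Dⁿ-toD-β M []       Ns = =βr-reflexive ≡-refl
toR-Dⁿ-toD-β M (t ∷ ts) Ns = etrans
  (=βr-reflexive (cong (λ M' → [ app M' (map bang Ns) ])
    (≡-trans (toR-Dⁿ-dif (toD M) t ts) (toRD-toD M (toR t ∷ toRs ts)))))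
  (wrapD-β (toR (toD M)) (toR t ∷ toRs ts) Ns)

mutual
  toR-toD : ∀ M → [ toR (toD M) ] =βr [ M ]
  toR-toD (var n)   = =βr-reflexive ≡-refl
  toR-toD (lam M)   = clam (toR-toD M)
  toR-toD (app M P) = etrans (toR-Dⁿ-toD-β M (toDLin P) (toRs (toDBang P)))
                             (capp (toR-toD M) (toR-toD-bag P))

  toR-toD-bag : ∀ P → [ map lin (toRs (toDLin P)) ++ map bang (toRs (toDBang P)) ] =βb [ P ]
  toR-toD-bag []           = =βb-refl
  toR-toD-bag (lin N ∷ P)  = clin (toR-toD N) (toR-toD-bag P)
  toR-toD-bag (bang N ∷ P) = etrans
    (struct (prep (↭.shift ≈ᵉ-setoid (≈bang ≈refl) (map lin (toRs (toDLin P))) _) (refl [])))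
    (cbang (toR-toD N) (toR-toD-bag P))

toRs-toDs : ∀ Ms → toRs (toDs Ms) =βr Ms
toRs-toDs []       = =βr-reflexive ≡-refl
toRs-toDs (M ∷ Ms) = csum (toR-toD M) (toRs-toDs Ms)

proposition6p17 :
    (∀ s → Ordinary s → toD (toR s) ≈ s)
    × ((Σ Sum λ S → ¬ (toDs (toRs S) ≈ₛ S)) × (Σ RSum λ Ms → ¬ (toRs (toDs Ms) ≈ʳₛ Ms)))
    × (∀ S → toDs (toRs S) =βη S)
    × (∀ Ms → toRs (toDs Ms) =βr Ms)
proposition6p17 =
  toD-toR-ordinary , (toDs-toRs-not-≈ₛ , toRs-toDs-not-≈ʳₛ) , toDs-toRs , toRs-toDs
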